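{- Let $U(x)=\tfrac12 x(x-1)$, and for $k\ge 0$ let $B_k(x)=\sum_{j=0}^{k}\binom{k}{j}B_j x^{k-j}$ denote the $k$-th Bernoulli polynomial, where $B_0,B_1,B_2,\dots$ are the Bernoulli numbers. Then: (a) For every integer $m\ge 2$: $B_3=B_5=\cdots=B_{2m-1}=0$ if and only if there exist non-zero rational numbers $\hat b_2^{(2m)},\dots,\hat b_m^{(2m)}$ such that $$B_{2m}(x)=B_{2m}+\sum_{j=2}^{m}\hat b_j^{(2m)}\,U(x)^j \quad\text{as polynomials in } x.$$ (b) For every integer $m\ge 1$: $B_3=B_5=\cdots=B_{2m+1}=0$ if and only if there exist non-zero rational numbers $\hat b_1^{(2m+1)},\dots,\hat b_m^{(2m+1)}$ such that $$B_{2m+1}(x)=\Big(x-\tfrac12\Big)\sum_{j=1}^{m}\hat b_j^{(2m+1)}\,U(x)^j \quad\text{as polynomials in } x.$$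
   Context: The Bernoulli numbers $B_j$ are the rational numbers defined by $\frac{t}{e^t-1}=\sum_{j\ge0}B_j\frac{t^j}{j!}$. The Bernoulli polynomials are $B_k(x)=\sum_{j=0}^{k}\binom{k}{j}B_j x^{k-j}$, so that $B_k(0)=B_k$. -}

module Defs where

open import Data.Nat as ℕ using (ℕ; zero; suc; _∸_)
open import Data.Nat.Combinatorics using (_C_)
open import Data.Integer using (+_)
import Data.Fin
open import Data.Fin using (Fin; toℕ; fromℕ)
open import Data.Vec using (Vec; []; _∷_; _∷ʳ_; lookup)
open import Data.List using (List; map; upTo; foldr)
open import Data.Rational using (ℚ; 0ℚ; 1ℚ; ½; _+_; _*_; _-_; -_; _/_)

ι : ℕ → ℚ
ι n = (+ n) / 1

pow : ℚ → ℕ → ℚ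
pow x zero = 1ℚ
pow x (suc n) = x * pow x n

-- [a, a+1, ..., b]  (empty if b < a)
range : ℕ → ℕ → List ℕ
range a b = map (a ℕ.+_) (upTo (suc b ∸ a))

sumRange : ℕ → ℕ → (ℕ → ℚ) → ℚ
sumRange a b f = foldr _+_ 0ℚ (map f (range a b))

sumFin : (n : ℕ) → (Fin n → ℚ) → ℚ
sumFin zero f = 0ℚ
sumFin (suc n) f = f Data.Fin.zero + sumFin n (λ i → f (Data.Fin.suc i))

-- Bernoulli numbers (convention B₁ = -1/2), from t/(e^t-1) = Σ B_j t^j/j!.
-- Comparing coefficients of t^(n+1)/(n+1)! in (e^t-1) · Σ B_j t^j/j! = t gives
-- B₀ = 1 and Σ_{j=0}^{n} C(n+1,j) B_j = 0 for n ≥ 1, i.e.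
-- B_n = -(1/(n+1)) Σ_{j<n} C(n+1,j) B_j.
-- bernVec n = [B₀, ..., B_n]
bernVec : (n : ℕ) → Vec ℚ (suc n)
bernVec zero = 1ℚ ∷ []
bernVec (suc n) = v ∷ʳ next
  where
  v : Vec ℚ (suc n)
  v = bernVec n
  next : ℚ
  next = - ((+ 1 / suc (suc n)) *
              sumFin (suc n) (λ j → ι (suc (suc n) C toℕ j) * lookup v j))

bernoulli : ℕ → ℚ
bernoulli n = lookup (bernVec n) (fromℕ n)

bernPoly : ℕ → ℚ → ℚ
bernPoly k x = sumRange 0 k (λ j → ι (k C j) * bernoulli j * pow x (k ∸ j))

U : ℚ → ℚ
U x = ½ * x * (x - 1ℚ)

module Submission where

-- Since U′ = x − ½ and
-- (x − ½)² = 2U + ¼, differentiation maps Σ aⱼ Uʲ to (x − ½) Σ (j+1) aⱼ₊₁ Uʲ, and maps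
-- (x − ½) Σ cⱼ Uʲ to Σ ((2j+1) cⱼ + ¼ (j+1) cⱼ₊₁) Uʲ. Integrating upwards from B₀ = 1 thus
-- produces polynomials W₂ₘ = Σ aⱼ Uʲ and W₂ₘ₊₁ = (x − ½) Σ cⱼ Uʲ with W′ₖ = k Wₖ₋₁, the
-- Appell relation of the Bernoulli polynomials; so Wₖ = Bₖ as soon as the constant terms
-- agree. For even k the constant term is chosen to be Bₖ; for odd k it is forced, because
-- Bₖ₊₁(1) = Bₖ₊₁(0) fixes ∫₀¹ Wₖ. Comparing B₂ₘ₊₁(0) = −½ c₀ with B₂ₘ₊₁(1) = ½ c₀ gives
-- c₀ = 0 for m ≥ 1: the odd Bernoulli numbers vanish (so both sides of each equivalence
-- hold) and a₁ = 0. Finally, solving (2j+1) cⱼ + ¼ (j+1) cⱼ₊₁ = (2m+1) aⱼ from the top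
-- and integrating aⱼ₊₁ = (2m+2) cⱼ / (j+1) both preserve strict alternation of signs, so
-- no coefficient of index j ≥ 1 (j ≥ 2 in the even case) vanishes.

open import Defs
open import Data.Nat as ℕ using (ℕ; zero; suc; _∸_; z≤n; s≤s; z<s; s<s)
import Data.Nat.Properties as ℕP
import Data.Nat.Solver
open import Data.Nat.Combinatorics using (_C_; nCk≡nC[n∸k]; nC1≡n; nCn≡1; k>n⇒nCk≡0; nCk+nC[k+1]≡[n+1]C[k+1])
open import Data.Nat.Coprimality as Coprime using (1-coprimeTo)
import Data.Integer as ℤ
import Data.Integer.Properties as ℤP
open import Data.Fin as Fin using (Fin; toℕ; fromℕ)
open import Data.Vec using (Vec; []; _∷_; _∷ʳ_; lookup)
open import Data.List using (_∷_; map; foldr; applyUpTo)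
open import Data.Rational using (ℚ; mkℚ; 0ℚ; 1ℚ; ½; -½; _+_; _*_; _-_; -_; _/_; _<_; _≤_; positive; nonNegative)
open import Data.Rational.Properties
open import Data.Rational.Solver using (module +-*-Solver)
open +-*-Solver using (solve; _:=_; _:+_; _:*_; _:-_; :-_; con)
open import Relation.Binary.PropositionalEquality
open import Relation.Nullary using (yes; no)
open import Function using (_∘_)
open import Function.Bundles using (_⇔_; mk⇔)
open import Data.Product using (Σ; _×_; _,_)
open import Algebra.Properties.Group +-0-group using (∙-cancelˡ; ∙-cancelʳ)
open import Level using (0ℓ)
open import Relation.Binary.Bundles using (Setoid)
import Relation.Binary.Reasoning.Setoid as SetoidReasoning

ι≡mkℚ : ∀ n → ι n ≡ mkℚ (ℤ.+ n) 0 (Coprime.sym (1-coprimeTo n))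
ι≡mkℚ n = normalize-coprime (Coprime.sym (1-coprimeTo n))

ι-suc : ∀ n → ι (suc n) ≡ 1ℚ + ι n
ι-suc n rewrite ι≡mkℚ n = cong (_/ 1) (cong (ℤ._+_ ℤ.1ℤ) (sym (ℤP.*-identityʳ (ℤ.+ n))))

ι-+ : ∀ m n → ι (m ℕ.+ n) ≡ ι m + ι n
ι-+ zero n = sym (+-identityˡ (ι n))
ι-+ (suc m) n = begin
  ι (suc m ℕ.+ n)     ≡⟨ ι-suc (m ℕ.+ n) ⟩
  1ℚ + ι (m ℕ.+ n)    ≡⟨ cong (1ℚ +_) (ι-+ m n) ⟩
  1ℚ + (ι m + ι n)    ≡⟨ +-assoc 1ℚ (ι m) (ι n) ⟨
  1ℚ + ι m + ι n      ≡⟨ cong (_+ ι n) (ι-suc m) ⟨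
  ι (suc m) + ι n     ∎
  where open ≡-Reasoning

ι-* : ∀ m n → ι (m ℕ.* n) ≡ ι m * ι n
ι-* zero n = sym (*-zeroˡ (ι n))
ι-* (suc m) n = begin
  ι (n ℕ.+ m ℕ.* n)    ≡⟨ ι-+ n (m ℕ.* n) ⟩
  ι n + ι (m ℕ.* n)    ≡⟨ cong (ι n +_) (ι-* m n) ⟩
  ι n + ι m * ι n      ≡⟨ solve 2 (λ a b → b :+ a :* b := (con 1ℚ :+ a) :* b) refl (ι m) (ι n) ⟩
  (1ℚ + ι m) * ι n     ≡⟨ cong (_* ι n) (ι-suc m) ⟨
  ι (suc m) * ι n      ∎
  where open ≡-Reasoning

ι-1+2n : ∀ n → ι (suc (n ℕ.+ n)) ≡ 1ℚ + ι 2 * ι n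
ι-1+2n n = begin
  ι (suc (n ℕ.+ n))    ≡⟨ ι-suc (n ℕ.+ n) ⟩
  1ℚ + ι (n ℕ.+ n)     ≡⟨ cong (1ℚ +_) (ι-+ n n) ⟩
  1ℚ + (ι n + ι n)     ≡⟨ solve 1 (λ t → con 1ℚ :+ (t :+ t) := con 1ℚ :+ con (ι 2) :* t) refl (ι n) ⟩
  1ℚ + ι 2 * ι n       ∎
  where open ≡-Reasoning

1/[1+_] : ℕ → ℚ
1/[1+ k ] = ℤ.+ 1 / suc k

1/[1+]≡mkℚ : ∀ k → 1/[1+ k ] ≡ mkℚ (ℤ.+ 1) k (1-coprimeTo (suc k))
1/[1+]≡mkℚ k = normalize-coprime (1-coprimeTo (suc k))

ι*1/[1+]≡1 : ∀ k → ι (suc k) * 1/[1+ k ] ≡ 1ℚ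
ι*1/[1+]≡1 k = trans (cong₂ _*_ (ι≡mkℚ (suc k)) (1/[1+]≡mkℚ k)) (*-inverseʳ (mkℚ (ℤ.+ suc k) 0 (Coprime.sym (1-coprimeTo (suc k)))))

ι-pos : ∀ k → 0ℚ < ι (suc k)
ι-pos k = subst (0ℚ <_) (sym (ι≡mkℚ (suc k))) (positive⁻¹ (mkℚ (ℤ.+ suc k) 0 (Coprime.sym (1-coprimeTo (suc k)))))

1/[1+]-pos : ∀ k → 0ℚ < 1/[1+ k ]
1/[1+]-pos k = subst (0ℚ <_) (sym (1/[1+]≡mkℚ k)) (positive⁻¹ (mkℚ (ℤ.+ 1) k (1-coprimeTo (suc k))))

ι*[x*1/[1+]]≡x : ∀ k x → ι (suc k) * (x * 1/[1+ k ]) ≡ x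
ι*[x*1/[1+]]≡x k x = begin
  ι (suc k) * (x * 1/[1+ k ])  ≡⟨ solve 3 (λ n x w → n :* (x :* w) := x :* (n :* w)) refl (ι (suc k)) x 1/[1+ k ] ⟩
  x * (ι (suc k) * 1/[1+ k ])  ≡⟨ cong (x *_) (ι*1/[1+]≡1 k) ⟩
  x * 1ℚ                       ≡⟨ *-identityʳ x ⟩
  x                            ∎
  where open ≡-Reasoning

ι-cancelˡ : ∀ k {a b} → ι (suc k) * a ≡ ι (suc k) * b → a ≡ b
ι-cancelˡ k {a} {b} eq = begin
  a                ≡⟨ ι*[x*1/[1+]]≡x k a ⟨
  n * (a * w)      ≡⟨ solve 3 (λ n a w → n :* (a :* w) := (n :* a) :* w) refl n a w ⟩
  (n * a) * w      ≡⟨ cong (_* w) eq ⟩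
  (n * b) * w      ≡⟨ solve 3 (λ n b w → (n :* b) :* w := n :* (b :* w)) refl n b w ⟩
  n * (b * w)      ≡⟨ ι*[x*1/[1+]]≡x k b ⟩
  b                ∎
  where
  open ≡-Reasoning
  n = ι (suc k)
  w = 1/[1+ k ]

0<*0< : ∀ {a b} → 0ℚ < a → 0ℚ < b → 0ℚ < a * b
0<*0< {a} {b} 0<a 0<b = positive⁻¹ (a * b) {{pos*pos⇒pos a {{positive 0<a}} b {{positive 0<b}}}}

0≤*0≤ : ∀ {a b} → 0ℚ ≤ a → 0ℚ ≤ b → 0ℚ ≤ a * b
0≤*0≤ {a} {b} 0≤a 0≤b = nonNegative⁻¹ (a * b) {{nonNeg*nonNeg⇒nonNeg a {{nonNegative 0≤a}} b {{nonNegative 0≤b}}}}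

0<+0≤ : ∀ {a b} → 0ℚ < a → 0ℚ ≤ b → 0ℚ < a + b
0<+0≤ {a} {b} 0<a 0≤b = positive⁻¹ (a + b) {{pos+nonNeg⇒pos a {{positive 0<a}} b {{nonNegative 0≤b}}}}

0<*⇒≢0 : ∀ e {a} → 0ℚ < e * a → a ≢ 0ℚ
0<*⇒≢0 e 0<ea a≡0 = <-irrefl (sym (trans (cong (e *_) a≡0) (*-zeroʳ e))) 0<ea

sum< : ℕ → (ℕ → ℚ) → ℚ
sum< zero f = 0ℚ
sum< (suc n) f = f 0 + sum< n (f ∘ suc)

sum<-cong-< : ∀ n {f g} → (∀ i → i ℕ.< n → f i ≡ g i) → sum< n f ≡ sum< n g
sum<-cong-< zero eq = refl
sum<-cong-< (suc n) eq = cong₂ _+_ (eq 0 z<s) (sum<-cong-< n (λ i i<n → eq (suc i) (s<s i<n)))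

sum<-cong : ∀ n {f g} → (∀ i → f i ≡ g i) → sum< n f ≡ sum< n g
sum<-cong n eq = sum<-cong-< n (λ i _ → eq i)

sum<-zero : ∀ n {f} → (∀ i → f i ≡ 0ℚ) → sum< n f ≡ 0ℚ
sum<-zero zero eq = refl
sum<-zero (suc n) eq = trans (cong₂ _+_ (eq 0) (sum<-zero n (eq ∘ suc))) (+-identityˡ 0ℚ)

sum<-+ : ∀ n f g → sum< n (λ i → f i + g i) ≡ sum< n f + sum< n g
sum<-+ zero f g = refl
sum<-+ (suc n) f g = trans (cong (f 0 + g 0 +_) (sum<-+ n (f ∘ suc) (g ∘ suc)))
  (solve 4 (λ a b c d → (a :+ b) :+ (c :+ d) := (a :+ c) :+ (b :+ d)) refl (f 0) (g 0) (sum< n (f ∘ suc)) (sum< n (g ∘ suc)))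

sum<-*ˡ : ∀ n c f → sum< n (λ i → c * f i) ≡ c * sum< n f
sum<-*ˡ zero c f = sym (*-zeroʳ c)
sum<-*ˡ (suc n) c f = trans (cong (c * f 0 +_) (sum<-*ˡ n c (f ∘ suc))) (sym (*-distribˡ-+ c (f 0) _))

sum<-suc : ∀ n f → sum< (suc n) f ≡ sum< n f + f n
sum<-suc zero f = trans (+-identityʳ (f 0)) (sym (+-identityˡ (f 0)))
sum<-suc (suc n) f = trans (cong (f 0 +_) (sum<-suc n (f ∘ suc))) (sym (+-assoc (f 0) _ _))

sum<-reverse : ∀ n f → sum< n f ≡ sum< n (λ i → f (n ∸ suc i))
sum<-reverse zero f = refl
sum<-reverse (suc n) f = begin
  f 0 + sum< n (f ∘ suc)                    ≡⟨ cong (f 0 +_) (sum<-reverse n (f ∘ suc)) ⟩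
  f 0 + sum< n (λ i → f (suc (n ∸ suc i)))  ≡⟨ +-comm (f 0) _ ⟩
  sum< n (λ i → f (suc (n ∸ suc i))) + f 0  ≡⟨ cong₂ _+_ (sum<-cong-< n (λ i i<n → cong f (sym (ℕP.+-∸-assoc 1 i<n))))
                                                          (cong f (sym (ℕP.n∸n≡0 n))) ⟩
  sum< n (λ i → f (n ∸ i)) + f (n ∸ n)      ≡⟨ sum<-suc n (λ i → f (n ∸ i)) ⟨
  sum< (suc n) (λ i → f (n ∸ i))            ∎
  where open ≡-Reasoning

map-applyUpTo : ∀ {A B : Set} (f : A → B) (g : ℕ → A) n → map f (applyUpTo g n) ≡ applyUpTo (f ∘ g) n
map-applyUpTo f g zero = refl
map-applyUpTo f g (suc n) = cong (f (g 0) ∷_) (map-applyUpTo f (g ∘ suc) n)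

foldr-applyUpTo : ∀ n f → foldr _+_ 0ℚ (applyUpTo f n) ≡ sum< n f
foldr-applyUpTo zero f = refl
foldr-applyUpTo (suc n) f = cong (f 0 +_) (foldr-applyUpTo n (f ∘ suc))

sumRange≡sum< : ∀ a b f → sumRange a b f ≡ sum< (suc b ∸ a) (λ j → f (a ℕ.+ j))
sumRange≡sum< a b f = begin
  foldr _+_ 0ℚ (map f (map (a ℕ.+_) (applyUpTo (λ i → i) n)))
    ≡⟨ cong (foldr _+_ 0ℚ ∘ map f) (map-applyUpTo (a ℕ.+_) (λ i → i) n) ⟩
  foldr _+_ 0ℚ (map f (applyUpTo (a ℕ.+_) n))
    ≡⟨ cong (foldr _+_ 0ℚ) (map-applyUpTo f (a ℕ.+_) n) ⟩
  foldr _+_ 0ℚ (applyUpTo (λ j → f (a ℕ.+ j)) n)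
    ≡⟨ foldr-applyUpTo n (λ j → f (a ℕ.+ j)) ⟩
  sum< n (λ j → f (a ℕ.+ j)) ∎
  where
  open ≡-Reasoning
  n = suc b ∸ a

sumFin≡sum< : ∀ n (f : Fin n → ℚ) g → (∀ j → f j ≡ g (toℕ j)) → sumFin n f ≡ sum< n g
sumFin≡sum< zero f g eq = refl
sumFin≡sum< (suc n) f g eq = cong₂ _+_ (eq Fin.zero) (sumFin≡sum< n (f ∘ Fin.suc) (g ∘ suc) (eq ∘ Fin.suc))

lookup-∷ʳ : ∀ {n} (v : Vec ℚ n) x (f : ℕ → ℚ) → (∀ j → lookup v j ≡ f (toℕ j)) → x ≡ f n →
  ∀ j → lookup (v ∷ʳ x) j ≡ f (toℕ j)
lookup-∷ʳ [] x f _ x≡fn Fin.zero = x≡fn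
lookup-∷ʳ (y ∷ v) x f v≡f _ Fin.zero = v≡f Fin.zero
lookup-∷ʳ (y ∷ v) x f v≡f x≡fn (Fin.suc j) = lookup-∷ʳ v x (f ∘ suc) (v≡f ∘ Fin.suc) x≡fn j

lookup-∷ʳ-last : ∀ {n} (v : Vec ℚ n) x → lookup (v ∷ʳ x) (fromℕ n) ≡ x
lookup-∷ʳ-last [] x = refl
lookup-∷ʳ-last (y ∷ v) x = lookup-∷ʳ-last v x

bernoulli-suc : ∀ n → bernoulli (suc n) ≡
  - (1/[1+ suc n ] * sumFin (suc n) (λ j → ι (suc (suc n) C toℕ j) * lookup (bernVec n) j))
bernoulli-suc n = lookup-∷ʳ-last (bernVec n) _

lookup-bernVec : ∀ n (j : Fin (suc n)) → lookup (bernVec n) j ≡ bernoulli (toℕ j)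
lookup-bernVec zero Fin.zero = refl
lookup-bernVec (suc n) = lookup-∷ʳ (bernVec n) _ bernoulli (lookup-bernVec n) (sym (lookup-∷ʳ-last (bernVec n) _))

bernoulli-recurrence : ∀ n → sum< (suc (suc n)) (λ j → ι (suc (suc n) C j) * bernoulli j) ≡ 0ℚ
bernoulli-recurrence n = begin
  sum< (suc (suc n)) term                          ≡⟨ sum<-suc (suc n) term ⟩
  S + ι (suc (suc n) C suc n) * bernoulli (suc n)  ≡⟨ cong₂ (λ c b → S + ι c * b) [n+2]C[n+1]≡n+2 (bernoulli-suc n) ⟩
  S + ι (suc (suc n)) * - (w * sumFin (suc n) f)   ≡⟨ cong (λ z → S + ι (suc (suc n)) * - (w * z)) sumFin≡S ⟩
  S + ι (suc (suc n)) * - (w * S)                  ≡⟨ solve 3 (λ s a w → s :+ a :* (:- (w :* s)) := (con 1ℚ :- a :* w) :* s) refl S (ι (suc (suc n))) w ⟩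
  (1ℚ - ι (suc (suc n)) * w) * S                   ≡⟨ cong (λ z → (1ℚ - z) * S) (ι*1/[1+]≡1 (suc n)) ⟩
  (1ℚ - 1ℚ) * S                                    ≡⟨ *-zeroˡ S ⟩
  0ℚ                                               ∎
  where
  open ≡-Reasoning
  term = λ j → ι (suc (suc n) C j) * bernoulli j
  S = sum< (suc n) term
  w = 1/[1+ suc n ]
  [n+2]C[n+1]≡n+2 : suc (suc n) C suc n ≡ suc (suc n)
  [n+2]C[n+1]≡n+2 = begin
    suc (suc n) C suc n                  ≡⟨ nCk≡nC[n∸k] (ℕP.n≤1+n (suc n)) ⟩
    suc (suc n) C (suc (suc n) ∸ suc n)  ≡⟨ cong (suc (suc n) C_) (ℕP.m+n∸n≡m 1 (suc n)) ⟩
    suc (suc n) C 1                      ≡⟨ nC1≡n (suc (suc n)) ⟩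
    suc (suc n)                          ∎
  f : Fin (suc n) → ℚ
  f j = ι (suc (suc n) C toℕ j) * lookup (bernVec n) j
  sumFin≡S : sumFin (suc n) f ≡ S
  sumFin≡S = sumFin≡sum< (suc n) f term (λ j → cong (ι (suc (suc n) C toℕ j) *_) (lookup-bernVec n j))

[1+i]*[1+k]C[1+i]≡[1+k]*kCi : ∀ k i → suc i ℕ.* (suc k C suc i) ≡ suc k ℕ.* (k C i)
[1+i]*[1+k]C[1+i]≡[1+k]*kCi zero zero = refl
[1+i]*[1+k]C[1+i]≡[1+k]*kCi zero (suc i) = begin
  suc (suc i) ℕ.* (1 C suc (suc i))  ≡⟨ cong (suc (suc i) ℕ.*_) (k>n⇒nCk≡0 {1} {suc (suc i)} (s<s (s<s z≤n))) ⟩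
  suc (suc i) ℕ.* 0                  ≡⟨ ℕP.*-zeroʳ (suc (suc i)) ⟩
  0                                  ≡⟨ cong (1 ℕ.*_) (k>n⇒nCk≡0 {0} {suc i} (s<s z≤n)) ⟨
  1 ℕ.* (0 C suc i)                  ∎
  where open ≡-Reasoning
[1+i]*[1+k]C[1+i]≡[1+k]*kCi (suc k) zero = begin
  1 ℕ.* (suc (suc k) C 1)  ≡⟨ ℕP.*-identityˡ _ ⟩
  suc (suc k) C 1          ≡⟨ nC1≡n (suc (suc k)) ⟩
  suc (suc k)              ≡⟨ ℕP.*-identityʳ (suc (suc k)) ⟨
  suc (suc k) ℕ.* 1        ∎
  where open ≡-Reasoning
[1+i]*[1+k]C[1+i]≡[1+k]*kCi (suc k) (suc i) = begin
  (2 ℕ.+ i) ℕ.* (suc (suc k) C (2 ℕ.+ i))           ≡⟨ cong ((2 ℕ.+ i) ℕ.*_) (nCk+nC[k+1]≡[n+1]C[k+1] (suc k) (suc i)) ⟨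
  (2 ℕ.+ i) ℕ.* (a ℕ.+ b)                          ≡⟨ NS.solve 3 (λ i a b → (NS.con 2 NS.:+ i) NS.:* (a NS.:+ b)
                                                         NS.:= ((NS.con 1 NS.:+ i) NS.:* a NS.:+ (NS.con 2 NS.:+ i) NS.:* b) NS.:+ a) refl i a b ⟩
  ((1 ℕ.+ i) ℕ.* a ℕ.+ (2 ℕ.+ i) ℕ.* b) ℕ.+ a      ≡⟨ cong₂ (λ u v → (u ℕ.+ v) ℕ.+ a) ([1+i]*[1+k]C[1+i]≡[1+k]*kCi k i) ([1+i]*[1+k]C[1+i]≡[1+k]*kCi k (suc i)) ⟩
  (suc k ℕ.* (k C i) ℕ.+ suc k ℕ.* (k C suc i)) ℕ.+ a  ≡⟨ cong (ℕ._+ a) (ℕP.*-distribˡ-+ (suc k) (k C i) (k C suc i)) ⟨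
  suc k ℕ.* (k C i ℕ.+ k C suc i) ℕ.+ a            ≡⟨ cong (λ z → suc k ℕ.* z ℕ.+ a) (nCk+nC[k+1]≡[n+1]C[k+1] k i) ⟩
  suc k ℕ.* a ℕ.+ a                                ≡⟨ ℕP.+-comm (suc k ℕ.* a) a ⟩
  suc (suc k) ℕ.* a                                ∎
  where
  open ≡-Reasoning
  module NS = Data.Nat.Solver.+-*-Solver
  a = suc k C suc i
  b = suc k C suc (suc i)

-- Polynomials as coefficient sequences

Poly : Set
Poly = ℕ → ℚ

infix 4 _≈_
record _≈_ (p q : Poly) : Set where
  constructor coeffwise
  field at : ∀ i → p i ≡ q i
open _≈_ public

≈-setoid : Setoid 0ℓ 0ℓ
≈-setoid = record
  { Carrier = Poly
  ; _≈_ = _≈_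
  ; isEquivalence = record
    { refl = coeffwise (λ _ → refl)
    ; sym = λ e → coeffwise (λ i → sym (at e i))
    ; trans = λ e f → coeffwise (λ i → trans (at e i) (at f i))
    }
  }

open Setoid ≈-setoid public using () renaming (refl to ≈-refl; sym to ≈-sym; trans to ≈-trans)
module ≈-Reasoning = SetoidReasoning ≈-setoid

infixl 6 _⊕_
infixr 7 _·_
infixr 8 X*_ [X-½]*_ U*_

0ₚ : Poly
0ₚ _ = 0ℚ

const : ℚ → Poly
const c zero = c
const c (suc i) = 0ℚ

_⊕_ : Poly → Poly → Poly
(p ⊕ q) i = p i + q i

_·_ : ℚ → Poly → Poly
(c · p) i = c * p i

X*_ : Poly → Poly
(X* p) zero = 0ℚ
(X* p) (suc i) = p i

∂ : Poly → Poly
∂ p i = ι (suc i) * p (suc i)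

[X-½]*_ : Poly → Poly
[X-½]* p = X* p ⊕ -½ · p

U*_ : Poly → Poly
U* p = ½ · (X* X* p ⊕ (- 1ℚ) · X* p)

⊕-cong : ∀ {p p′ q q′} → p ≈ p′ → q ≈ q′ → p ⊕ q ≈ p′ ⊕ q′
⊕-cong e f = coeffwise (λ i → cong₂ _+_ (at e i) (at f i))

⊕-congˡ : ∀ {p p′} q → p ≈ p′ → p ⊕ q ≈ p′ ⊕ q
⊕-congˡ q e = ⊕-cong e (≈-refl {q})

⊕-congʳ : ∀ p {q q′} → q ≈ q′ → p ⊕ q ≈ p ⊕ q′
⊕-congʳ p e = ⊕-cong (≈-refl {p}) e

⊕-identityˡ : ∀ p → 0ₚ ⊕ p ≈ p
⊕-identityˡ p = coeffwise (λ i → +-identityˡ (p i))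

⊕-identityʳ : ∀ p → p ⊕ 0ₚ ≈ p
⊕-identityʳ p = coeffwise (λ i → +-identityʳ (p i))

⊕-interchange : ∀ p q r s → (p ⊕ q) ⊕ (r ⊕ s) ≈ (p ⊕ r) ⊕ (q ⊕ s)
⊕-interchange p q r s = coeffwise (λ i →
  solve 4 (λ a b c d → (a :+ b) :+ (c :+ d) := (a :+ c) :+ (b :+ d)) refl (p i) (q i) (r i) (s i))

const-cong : ∀ {a b} → a ≡ b → const a ≈ const b
const-cong refl = ≈-refl

const-0 : const 0ℚ ≈ 0ₚ
const-0 = coeffwise λ { zero → refl ; (suc i) → refl }

const-⊕ : ∀ a b → const a ⊕ const b ≈ const (a + b)
const-⊕ a b = coeffwise λ { zero → refl ; (suc i) → refl }

const-· : ∀ c a → c · const a ≈ const (c * a)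
const-· c a = coeffwise λ { zero → refl ; (suc i) → *-zeroʳ c }

record IsLinear (f : Poly → Poly) : Set where
  field
    map-≈ : ∀ {p q} → p ≈ q → f p ≈ f q
    map-⊕ : ∀ p q → f (p ⊕ q) ≈ f p ⊕ f q
    map-· : ∀ c p → f (c · p) ≈ c · f p

  map-0 : f 0ₚ ≈ 0ₚ
  map-0 = ≈-trans (map-≈ (coeffwise (λ i → sym (*-zeroˡ 0ℚ)))) (≈-trans (map-· 0ℚ 0ₚ) (coeffwise (λ i → *-zeroˡ (f 0ₚ i))))
open IsLinear public

·-linear : ∀ c → IsLinear (c ·_)
·-linear c = record
  { map-≈ = λ e → coeffwise (λ i → cong (c *_) (at e i))
  ; map-⊕ = λ p q → coeffwise (λ i → *-distribˡ-+ c (p i) (q i))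
  ; map-· = λ d p → coeffwise (λ i → solve 3 (λ c d a → c :* (d :* a) := d :* (c :* a)) refl c d (p i))
  }

⊕-linear : ∀ {f g} → IsLinear f → IsLinear g → IsLinear (λ p → f p ⊕ g p)
⊕-linear {f} {g} F G = record
  { map-≈ = λ e → ⊕-cong (map-≈ F e) (map-≈ G e)
  ; map-⊕ = λ p q → ≈-trans (⊕-cong (map-⊕ F p q) (map-⊕ G p q)) (⊕-interchange (f p) (f q) (g p) (g q))
  ; map-· = λ c p → ≈-trans (⊕-cong (map-· F c p) (map-· G c p)) (≈-sym (map-⊕ (·-linear c) (f p) (g p)))
  }

∘-linear : ∀ {f g} → IsLinear f → IsLinear g → IsLinear (f ∘ g)
∘-linear {f} {g} F G = record
  { map-≈ = map-≈ F ∘ map-≈ G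
  ; map-⊕ = λ p q → ≈-trans (map-≈ F (map-⊕ G p q)) (map-⊕ F (g p) (g q))
  ; map-· = λ c p → ≈-trans (map-≈ F (map-· G c p)) (map-· F c (g p))
  }

X*-linear : IsLinear X*_
X*-linear = record
  { map-≈ = λ e → coeffwise λ { zero → refl ; (suc i) → at e i }
  ; map-⊕ = λ p q → coeffwise λ { zero → sym (+-identityˡ 0ℚ) ; (suc i) → refl }
  ; map-· = λ c p → coeffwise λ { zero → sym (*-zeroʳ c) ; (suc i) → refl }
  }

∂-linear : IsLinear ∂
∂-linear = record
  { map-≈ = λ e → coeffwise (λ i → cong (ι (suc i) *_) (at e (suc i)))
  ; map-⊕ = λ p q → coeffwise (λ i → *-distribˡ-+ (ι (suc i)) (p (suc i)) (q (suc i)))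
  ; map-· = λ c p → coeffwise (λ i → solve 3 (λ n c a → n :* (c :* a) := c :* (n :* a)) refl (ι (suc i)) c (p (suc i)))
  }

[X-½]*-linear : IsLinear [X-½]*_
[X-½]*-linear = ⊕-linear X*-linear (·-linear -½)

U*-linear : IsLinear U*_
U*-linear = ∘-linear (·-linear ½) (⊕-linear (∘-linear X*-linear X*-linear) (∘-linear (·-linear (- 1ℚ)) X*-linear))

¼ : ℚ
¼ = ℤ.+ 1 / 4

∂-const : ∀ c → ∂ (const c) ≈ 0ₚ
∂-const c = coeffwise (λ i → *-zeroʳ (ι (suc i)))

∂-[X-½]* : ∀ p → ∂ ([X-½]* p) ≈ p ⊕ [X-½]* ∂ p
∂-[X-½]* p = coeffwise coeff
  where
  coeff : ∀ i → ∂ ([X-½]* p) i ≡ (p ⊕ [X-½]* ∂ p) i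
  coeff zero = solve 2 (λ a b → con 1ℚ :* (a :+ con -½ :* b) := a :+ (con 0ℚ :+ con -½ :* (con 1ℚ :* b))) refl (p 0) (p 1)
  coeff (suc k) = begin
    ι (suc (suc k)) * (a + -½ * b)                        ≡⟨ cong (λ n → n * (a + -½ * b)) (ι-suc (suc k)) ⟩
    (1ℚ + t) * (a + -½ * b)                               ≡⟨ solve 3 (λ t a b → (con 1ℚ :+ t) :* (a :+ con -½ :* b)
                                                                        := a :+ (t :* a :+ con -½ :* ((con 1ℚ :+ t) :* b))) refl t a b ⟩
    a + (t * a + -½ * ((1ℚ + t) * b))                     ≡⟨ cong (λ n → a + (t * a + -½ * (n * b))) (ι-suc (suc k)) ⟨
    a + (t * a + -½ * (ι (suc (suc k)) * b))              ∎
    where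
    open ≡-Reasoning
    t = ι (suc k)
    a = p (suc k)
    b = p (suc (suc k))

∂-U* : ∀ p → ∂ (U* p) ≈ [X-½]* p ⊕ U* ∂ p
∂-U* p = coeffwise coeff
  where
  coeff : ∀ i → ∂ (U* p) i ≡ ([X-½]* p ⊕ U* ∂ p) i
  coeff zero = solve 1 (λ a → con 1ℚ :* (con ½ :* (con 0ℚ :+ con (- 1ℚ) :* a))
                           := (con 0ℚ :+ con -½ :* a) :+ con ½ :* (con 0ℚ :+ con (- 1ℚ) :* con 0ℚ)) refl (p 0)
  coeff (suc zero) = solve 2 (λ a b → con (ι 2) :* (con ½ :* (a :+ con (- 1ℚ) :* b))
                                 := (a :+ con -½ :* b) :+ con ½ :* (con 0ℚ :+ con (- 1ℚ) :* (con 1ℚ :* b))) refl (p 0) (p 1)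
  coeff (suc (suc k)) = begin
    ι (suc (suc (suc k))) * (½ * (a + (- 1ℚ) * b))
      ≡⟨ cong (λ n → n * (½ * (a + (- 1ℚ) * b))) (trans (ι-suc (suc (suc k))) (cong (1ℚ +_) (ι-suc (suc k)))) ⟩
    (1ℚ + (1ℚ + t)) * (½ * (a + (- 1ℚ) * b))
      ≡⟨ solve 3 (λ t a b → (con 1ℚ :+ (con 1ℚ :+ t)) :* (con ½ :* (a :+ con (- 1ℚ) :* b))
                          := (a :+ con -½ :* b) :+ con ½ :* (t :* a :+ con (- 1ℚ) :* ((con 1ℚ :+ t) :* b))) refl t a b ⟩
    (a + -½ * b) + ½ * (t * a + (- 1ℚ) * ((1ℚ + t) * b))
      ≡⟨ cong (λ n → (a + -½ * b) + ½ * (t * a + (- 1ℚ) * (n * b))) (ι-suc (suc k)) ⟨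
    (a + -½ * b) + ½ * (t * a + (- 1ℚ) * (ι (suc (suc k)) * b))
      ∎
    where
    open ≡-Reasoning
    t = ι (suc k)
    a = p (suc k)
    b = p (suc (suc k))

[X-½]*[X-½]* : ∀ p → [X-½]* [X-½]* p ≈ ι 2 · U* p ⊕ ¼ · p
[X-½]*[X-½]* p = coeffwise coeff
  where
  coeff : ∀ i → ([X-½]* [X-½]* p) i ≡ (ι 2 · U* p ⊕ ¼ · p) i
  coeff zero = solve 1 (λ a → con 0ℚ :+ con -½ :* (con 0ℚ :+ con -½ :* a)
                           := con (ι 2) :* (con ½ :* (con 0ℚ :+ con (- 1ℚ) :* con 0ℚ)) :+ con ¼ :* a) refl (p 0)
  coeff (suc zero) = solve 2 (λ a b → (con 0ℚ :+ con -½ :* a) :+ con -½ :* (a :+ con -½ :* b)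
                                 := con (ι 2) :* (con ½ :* (con 0ℚ :+ con (- 1ℚ) :* a)) :+ con ¼ :* b) refl (p 0) (p 1)
  coeff (suc (suc k)) = solve 3 (λ a b c → (a :+ con -½ :* b) :+ con -½ :* (b :+ con -½ :* c)
                                      := con (ι 2) :* (con ½ :* (a :+ con (- 1ℚ) :* b)) :+ con ¼ :* c) refl (p k) (p (suc k)) (p (suc (suc k)))

U*[X-½]*≈[X-½]*U* : ∀ p → U* [X-½]* p ≈ [X-½]* U* p
U*[X-½]*≈[X-½]*U* p = coeffwise coeff
  where
  coeff : ∀ i → (U* [X-½]* p) i ≡ ([X-½]* U* p) i
  coeff zero = solve 0 (con ½ :* (con 0ℚ :+ con (- 1ℚ) :* con 0ℚ)
                        := con 0ℚ :+ con -½ :* (con ½ :* (con 0ℚ :+ con (- 1ℚ) :* con 0ℚ))) refl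
  coeff (suc zero) = solve 1 (λ a → con ½ :* (con 0ℚ :+ con (- 1ℚ) :* (con 0ℚ :+ con -½ :* a))
                                := con ½ :* (con 0ℚ :+ con (- 1ℚ) :* con 0ℚ) :+ con -½ :* (con ½ :* (con 0ℚ :+ con (- 1ℚ) :* a))) refl (p 0)
  coeff (suc (suc k)) = solve 3 (λ x a b → con ½ :* ((x :+ con -½ :* a) :+ con (- 1ℚ) :* (a :+ con -½ :* b))
                                      := con ½ :* (x :+ con (- 1ℚ) :* a) :+ con -½ :* (con ½ :* (a :+ con (- 1ℚ) :* b)))
      refl ((X* p) k) (p k) (p (suc k))

-- Degrees are not tracked: ev N only sees the coefficients below N.
ev : ℕ → Poly → ℚ → ℚ
ev N p x = sum< N (λ i → p i * pow x i)

ev-cong : ∀ N {p q} x → p ≈ q → ev N p x ≡ ev N q x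
ev-cong N x e = sum<-cong N (λ i → cong (_* pow x i) (at e i))

ev-⊕ : ∀ N p q x → ev N (p ⊕ q) x ≡ ev N p x + ev N q x
ev-⊕ N p q x = trans (sum<-cong N (λ i → *-distribʳ-+ (pow x i) (p i) (q i))) (sum<-+ N _ _)

ev-· : ∀ N c p x → ev N (c · p) x ≡ c * ev N p x
ev-· N c p x = trans (sum<-cong N (λ i → *-assoc c (p i) (pow x i))) (sum<-*ˡ N c _)

ev-horner : ∀ N a x → ev (suc N) a x ≡ a 0 + x * ev N (a ∘ suc) x
ev-horner N a x = begin
  a 0 * 1ℚ + sum< N (λ i → a (suc i) * (x * pow x i))  ≡⟨ cong₂ _+_ (*-identityʳ (a 0)) (sum<-cong N (λ i → x*[b*c]≡b*[x*c] (a (suc i)) (pow x i))) ⟩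
  a 0 + sum< N (λ i → x * (a (suc i) * pow x i))       ≡⟨ cong (a 0 +_) (sum<-*ˡ N x _) ⟩
  a 0 + x * ev N (a ∘ suc) x                            ∎
  where
  open ≡-Reasoning
  x*[b*c]≡b*[x*c] : ∀ b c → b * (x * c) ≡ x * (b * c)
  x*[b*c]≡b*[x*c] b c = solve 3 (λ b c x → b :* (x :* c) := x :* (b :* c)) refl b c x

ev-X* : ∀ N p x → ev (suc N) (X* p) x ≡ x * ev N p x
ev-X* N p x = trans (ev-horner N (X* p) x) (+-identityˡ _)

ev-suc : ∀ N p x → p N ≡ 0ℚ → ev (suc N) p x ≡ ev N p x
ev-suc N p x pN≡0 = begin
  ev (suc N) p x              ≡⟨ sum<-suc N _ ⟩
  ev N p x + p N * pow x N    ≡⟨ cong (λ c → ev N p x + c * pow x N) pN≡0 ⟩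
  ev N p x + 0ℚ * pow x N     ≡⟨ cong (ev N p x +_) (*-zeroˡ (pow x N)) ⟩
  ev N p x + 0ℚ               ≡⟨ +-identityʳ _ ⟩
  ev N p x                    ∎
  where open ≡-Reasoning

ev-const : ∀ N c x → ev (suc N) (const c) x ≡ c
ev-const N c x = trans (cong₂ _+_ (*-identityʳ c) (sum<-zero N (λ i → *-zeroˡ (pow x (suc i))))) (+-identityʳ c)

ev-[X-½]* : ∀ N p x → p N ≡ 0ℚ → ev (suc N) ([X-½]* p) x ≡ (x - ½) * ev N p x
ev-[X-½]* N p x pN≡0 = begin
  ev (suc N) ([X-½]* p) x                       ≡⟨ ev-⊕ (suc N) (X* p) (-½ · p) x ⟩
  ev (suc N) (X* p) x + ev (suc N) (-½ · p) x   ≡⟨ cong₂ _+_ (ev-X* N p x) (trans (ev-· (suc N) -½ p x) (cong (-½ *_) (ev-suc N p x pN≡0))) ⟩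
  x * ev N p x + -½ * ev N p x                  ≡⟨ solve 2 (λ x e → x :* e :+ con -½ :* e := (x :- con ½) :* e) refl x (ev N p x) ⟩
  (x - ½) * ev N p x                            ∎
  where open ≡-Reasoning

ev-U* : ∀ N p x → p N ≡ 0ℚ → ev (suc (suc N)) (U* p) x ≡ U x * ev N p x
ev-U* N p x pN≡0 = begin
  ev (suc (suc N)) (U* p) x
    ≡⟨ ev-· (suc (suc N)) ½ (X* X* p ⊕ (- 1ℚ) · X* p) x ⟩
  ½ * ev (suc (suc N)) (X* X* p ⊕ (- 1ℚ) · X* p) x
    ≡⟨ cong (½ *_) (ev-⊕ (suc (suc N)) (X* X* p) ((- 1ℚ) · X* p) x) ⟩
  ½ * (ev (suc (suc N)) (X* X* p) x + ev (suc (suc N)) ((- 1ℚ) · X* p) x)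
    ≡⟨ cong₂ (λ u v → ½ * (u + v)) (trans (ev-X* (suc N) (X* p) x) (cong (x *_) (ev-X* N p x)))
                                  (trans (ev-· (suc (suc N)) (- 1ℚ) (X* p) x) (cong ((- 1ℚ) *_) (ev-X* (suc N) p x))) ⟩
  ½ * (x * (x * ev N p x) + (- 1ℚ) * (x * ev (suc N) p x))
    ≡⟨ cong (λ e → ½ * (x * (x * ev N p x) + (- 1ℚ) * (x * e))) (ev-suc N p x pN≡0) ⟩
  ½ * (x * (x * ev N p x) + (- 1ℚ) * (x * ev N p x))
    ≡⟨ solve 2 (λ x e → con ½ :* (x :* (x :* e) :+ con (- 1ℚ) :* (x :* e)) := con ½ :* x :* (x :- con 1ℚ) :* e) refl x (ev N p x) ⟩
  U x * ev N p x
    ∎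
  where open ≡-Reasoning

ev-at-0 : ∀ N p → ev (suc N) p 0ℚ ≡ p 0
ev-at-0 N p = trans (ev-horner N p 0ℚ) (trans (cong (p 0 +_) (*-zeroˡ (ev N (p ∘ suc) 0ℚ))) (+-identityʳ (p 0)))

∂-injective : ∀ {p q} → ∂ p ≈ ∂ q → p 0 ≡ q 0 → p ≈ q
∂-injective ∂p≈∂q p0≡q0 = coeffwise λ where
  zero → p0≡q0
  (suc i) → ι-cancelˡ i (at ∂p≈∂q i)

coeff-1-from-value-at-1 : ∀ N p q → p 0 ≡ q 0 → (∀ i → p (suc (suc i)) ≡ q (suc (suc i))) →
  ev (suc (suc N)) p 1ℚ ≡ ev (suc (suc N)) q 1ℚ → p 1 ≡ q 1
coeff-1-from-value-at-1 N p q p0≡q0 tails-agree p[1]≡q[1] =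
  ∙-cancelʳ (ev N tail-q 1ℚ) (p 1) (q 1) (∙-cancelˡ (q 0) (p 1 + ev N tail-q 1ℚ) (q 1 + ev N tail-q 1ℚ) (begin
    q 0 + (p 1 + ev N tail-q 1ℚ)          ≡⟨ cong₂ (λ a r → a + (p 1 + r)) p0≡q0 (ev-cong N 1ℚ (coeffwise tails-agree)) ⟨
    p 0 + (p 1 + ev N (p ∘ suc ∘ suc) 1ℚ)  ≡⟨ value-at-1 p ⟨
    ev (suc (suc N)) p 1ℚ                   ≡⟨ p[1]≡q[1] ⟩
    ev (suc (suc N)) q 1ℚ                   ≡⟨ value-at-1 q ⟩
    q 0 + (q 1 + ev N tail-q 1ℚ)            ∎))
  where
  open ≡-Reasoning
  tail-q = q ∘ suc ∘ suc
  value-at-1 : ∀ r → ev (suc (suc N)) r 1ℚ ≡ r 0 + (r 1 + ev N (r ∘ suc ∘ suc) 1ℚ)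
  value-at-1 r = begin
    ev (suc (suc N)) r 1ℚ                              ≡⟨ ev-horner (suc N) r 1ℚ ⟩
    r 0 + 1ℚ * ev (suc N) (r ∘ suc) 1ℚ                 ≡⟨ cong (λ e → r 0 + 1ℚ * e) (ev-horner N (r ∘ suc) 1ℚ) ⟩
    r 0 + 1ℚ * (r 1 + 1ℚ * ev N (r ∘ suc ∘ suc) 1ℚ)    ≡⟨ cong (λ e → r 0 + e) (trans (*-identityˡ _) (cong (r 1 +_) (*-identityˡ _))) ⟩
    r 0 + (r 1 + ev N (r ∘ suc ∘ suc) 1ℚ)              ∎

-- Polynomials in U

Uexp : ℕ → (ℕ → ℚ) → Poly
Uexp zero a = const (a 0)
Uexp (suc m) a = const (a 0) ⊕ U* Uexp m (a ∘ suc)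

0∷_ : (ℕ → ℚ) → ℕ → ℚ
(0∷ a) zero = 0ℚ
(0∷ a) (suc j) = a j

Uexp-cong : ∀ m {a b} → (∀ j → a j ≡ b j) → Uexp m a ≈ Uexp m b
Uexp-cong zero eq = const-cong (eq 0)
Uexp-cong (suc m) eq = ⊕-cong (const-cong (eq 0)) (map-≈ U*-linear (Uexp-cong m (eq ∘ suc)))

Uexp-⊕ : ∀ m a b → Uexp m a ⊕ Uexp m b ≈ Uexp m (λ j → a j + b j)
Uexp-⊕ zero a b = const-⊕ (a 0) (b 0)
Uexp-⊕ (suc m) a b = begin
  (const (a 0) ⊕ U* Uexp m (a ∘ suc)) ⊕ (const (b 0) ⊕ U* Uexp m (b ∘ suc))
    ≈⟨ ⊕-interchange (const (a 0)) _ (const (b 0)) _ ⟩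
  (const (a 0) ⊕ const (b 0)) ⊕ (U* Uexp m (a ∘ suc) ⊕ U* Uexp m (b ∘ suc))
    ≈⟨ ⊕-cong (const-⊕ (a 0) (b 0)) (≈-sym (map-⊕ U*-linear (Uexp m (a ∘ suc)) (Uexp m (b ∘ suc)))) ⟩
  const (a 0 + b 0) ⊕ U* (Uexp m (a ∘ suc) ⊕ Uexp m (b ∘ suc))
    ≈⟨ ⊕-congʳ (const (a 0 + b 0)) (map-≈ U*-linear (Uexp-⊕ m (a ∘ suc) (b ∘ suc))) ⟩
  Uexp (suc m) (λ j → a j + b j) ∎
  where open ≈-Reasoning

Uexp-· : ∀ m c a → c · Uexp m a ≈ Uexp m (λ j → c * a j)
Uexp-· zero c a = const-· c (a 0)
Uexp-· (suc m) c a = begin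
  c · (const (a 0) ⊕ U* Uexp m (a ∘ suc))      ≈⟨ map-⊕ (·-linear c) (const (a 0)) (U* Uexp m (a ∘ suc)) ⟩
  c · const (a 0) ⊕ c · U* Uexp m (a ∘ suc)    ≈⟨ ⊕-cong (const-· c (a 0)) (≈-sym (map-· U*-linear c (Uexp m (a ∘ suc)))) ⟩
  const (c * a 0) ⊕ U* (c · Uexp m (a ∘ suc))  ≈⟨ ⊕-congʳ (const (c * a 0)) (map-≈ U*-linear (Uexp-· m c (a ∘ suc))) ⟩
  Uexp (suc m) (λ j → c * a j)                 ∎
  where open ≈-Reasoning

Uexp-0 : ∀ m a → Uexp m a 0 ≡ a 0
Uexp-0 zero a = refl
Uexp-0 (suc m) a = solve 1 (λ x → x :+ con ½ :* (con 0ℚ :+ con (- 1ℚ) :* con 0ℚ) := x) refl (a 0)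

Uexp-vanishes : ∀ m a i → m ℕ.+ m ℕ.< i → Uexp m a i ≡ 0ℚ
Uexp-vanishes zero a (suc i) _ = refl
Uexp-vanishes (suc m) a (suc (suc k)) (s<s 2m+1<k+2) =
  cong₂ (λ u v → 0ℚ + ½ * (u + (- 1ℚ) * v)) (Uexp-vanishes m (a ∘ suc) k 2m<k)
                                           (Uexp-vanishes m (a ∘ suc) (suc k) (ℕP.m<n⇒m<1+n 2m<k))
  where
  2m<k : m ℕ.+ m ℕ.< k
  2m<k = ℕP.≤-pred (subst (ℕ._< suc k) (ℕP.+-suc m m) 2m+1<k+2)

Uexp-suc : ∀ m a → a (suc m) ≡ 0ℚ → Uexp (suc m) a ≈ Uexp m a
Uexp-suc zero a a1≡0 = begin
  const (a 0) ⊕ U* const (a 1)  ≈⟨ ⊕-congʳ (const (a 0)) (map-≈ U*-linear (≈-trans (const-cong a1≡0) const-0)) ⟩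
  const (a 0) ⊕ U* 0ₚ           ≈⟨ ⊕-congʳ (const (a 0)) (map-0 U*-linear) ⟩
  const (a 0) ⊕ 0ₚ              ≈⟨ ⊕-identityʳ (const (a 0)) ⟩
  const (a 0)                   ∎
  where open ≈-Reasoning
Uexp-suc (suc m) a eq = ⊕-congʳ (const (a 0)) (map-≈ U*-linear (Uexp-suc m (a ∘ suc) eq))

U*Uexp : ∀ m a → U* Uexp m a ≈ Uexp (suc m) (0∷ a)
U*Uexp m a = ≈-sym (≈-trans (⊕-congˡ (U* Uexp m a) const-0) (⊕-identityˡ (U* Uexp m a)))

Uexp-⊕-U*Uexp : ∀ m a b → Uexp (suc m) a ⊕ U* Uexp m b ≈ Uexp (suc m) (λ j → a j + (0∷ b) j)
Uexp-⊕-U*Uexp m a b = ≈-trans (⊕-congʳ (Uexp (suc m) a) (U*Uexp m b)) (Uexp-⊕ (suc m) a (0∷ b))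

ev-Uexp : ∀ m a x → ev (suc (m ℕ.+ m)) (Uexp m a) x ≡ ev (suc m) a (U x)
ev-Uexp zero a x = trans (ev-const 0 (a 0) x) (sym (trans (+-identityʳ _) (*-identityʳ (a 0))))
ev-Uexp (suc m) a x = begin
  ev (suc (suc m ℕ.+ suc m)) (Uexp (suc m) a) x
    ≡⟨ cong (λ N → ev (suc (suc N)) (Uexp (suc m) a) x) (ℕP.+-suc m m) ⟩
  ev (suc (suc M)) (const (a 0) ⊕ U* Uexp m (a ∘ suc)) x
    ≡⟨ ev-⊕ (suc (suc M)) (const (a 0)) (U* Uexp m (a ∘ suc)) x ⟩
  ev (suc (suc M)) (const (a 0)) x + ev (suc (suc M)) (U* Uexp m (a ∘ suc)) x
    ≡⟨ cong₂ _+_ (ev-const (suc M) (a 0) x) (ev-U* M (Uexp m (a ∘ suc)) x (Uexp-vanishes m (a ∘ suc) M ℕP.≤-refl)) ⟩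
  a 0 + U x * ev M (Uexp m (a ∘ suc)) x
    ≡⟨ cong (λ e → a 0 + U x * e) (ev-Uexp m (a ∘ suc) x) ⟩
  a 0 + U x * ev (suc m) (a ∘ suc) (U x)
    ≡⟨ ev-horner (suc m) a (U x) ⟨
  ev (suc (suc m)) a (U x) ∎
  where
  open ≡-Reasoning
  M = suc (m ℕ.+ m)

∂-Uexp : ∀ m a → ∂ (Uexp (suc m) a) ≈ [X-½]* Uexp m (λ j → ι (suc j) * a (suc j))
∂-Uexp zero a = begin
  ∂ (const (a 0) ⊕ U* const (a 1))              ≈⟨ map-⊕ ∂-linear (const (a 0)) (U* const (a 1)) ⟩
  ∂ (const (a 0)) ⊕ ∂ (U* const (a 1))          ≈⟨ ⊕-cong (∂-const (a 0)) (∂-U* (const (a 1))) ⟩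
  0ₚ ⊕ ([X-½]* const (a 1) ⊕ U* ∂ (const (a 1)))  ≈⟨ ⊕-identityˡ ([X-½]* const (a 1) ⊕ U* ∂ (const (a 1))) ⟩
  [X-½]* const (a 1) ⊕ U* ∂ (const (a 1))         ≈⟨ ⊕-congʳ ([X-½]* const (a 1)) (≈-trans (map-≈ U*-linear (∂-const (a 1))) (map-0 U*-linear)) ⟩
  [X-½]* const (a 1) ⊕ 0ₚ                       ≈⟨ ⊕-identityʳ ([X-½]* const (a 1)) ⟩
  [X-½]* const (a 1)                            ≈⟨ map-≈ [X-½]*-linear (const-cong (sym (*-identityˡ (a 1)))) ⟩
  [X-½]* const (ι 1 * a 1)                      ∎
  where open ≈-Reasoning
∂-Uexp (suc m) a = begin
  ∂ (const (a 0) ⊕ U* Uexp (suc m) a′)                 ≈⟨ map-⊕ ∂-linear (const (a 0)) (U* Uexp (suc m) a′) ⟩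
  ∂ (const (a 0)) ⊕ ∂ (U* Uexp (suc m) a′)             ≈⟨ ⊕-cong (∂-const (a 0)) (∂-U* (Uexp (suc m) a′)) ⟩
  0ₚ ⊕ ([X-½]* Uexp (suc m) a′ ⊕ U* ∂ (Uexp (suc m) a′)) ≈⟨ ⊕-identityˡ ([X-½]* Uexp (suc m) a′ ⊕ U* ∂ (Uexp (suc m) a′)) ⟩
  [X-½]* Uexp (suc m) a′ ⊕ U* ∂ (Uexp (suc m) a′)        ≈⟨ ⊕-congʳ ([X-½]* Uexp (suc m) a′) (map-≈ U*-linear (∂-Uexp m a′)) ⟩
  [X-½]* Uexp (suc m) a′ ⊕ U* [X-½]* Uexp m b          ≈⟨ ⊕-congʳ ([X-½]* Uexp (suc m) a′) (U*[X-½]*≈[X-½]*U* (Uexp m b)) ⟩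
  [X-½]* Uexp (suc m) a′ ⊕ [X-½]* U* Uexp m b          ≈⟨ map-⊕ [X-½]*-linear (Uexp (suc m) a′) (U* Uexp m b) ⟨
  [X-½]* (Uexp (suc m) a′ ⊕ U* Uexp m b)               ≈⟨ map-≈ [X-½]*-linear (Uexp-⊕-U*Uexp m a′ b) ⟩
  [X-½]* Uexp (suc m) (λ j → a′ j + (0∷ b) j)          ≈⟨ map-≈ [X-½]*-linear (Uexp-cong (suc m) coeff) ⟩
  [X-½]* Uexp (suc m) (λ j → ι (suc j) * a′ j)         ∎
  where
  open ≈-Reasoning
  a′ = a ∘ suc
  b = λ j → ι (suc j) * a′ (suc j)
  coeff : ∀ j → a′ j + (0∷ b) j ≡ ι (suc j) * a′ j
  coeff zero = trans (+-identityʳ (a 1)) (sym (*-identityˡ (a 1)))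
  coeff (suc j) = trans (solve 2 (λ t x → x :+ t :* x := (con 1ℚ :+ t) :* x) refl (ι (suc j)) (a (suc (suc j))))
                        (cong (_* a (suc (suc j))) (sym (ι-suc (suc j))))

∂-[X-½]*Uexp : ∀ m c → (∀ j → m ℕ.< j → c j ≡ 0ℚ) →
  ∂ ([X-½]* Uexp m c) ≈ Uexp m (λ j → ι (suc (j ℕ.+ j)) * c j + ¼ * (ι (suc j) * c (suc j)))
∂-[X-½]*Uexp zero c c-vanishes = begin
  ∂ ([X-½]* const (c 0))                 ≈⟨ ∂-[X-½]* (const (c 0)) ⟩
  const (c 0) ⊕ [X-½]* ∂ (const (c 0))     ≈⟨ ⊕-congʳ (const (c 0)) (≈-trans (map-≈ [X-½]*-linear (∂-const (c 0))) (map-0 [X-½]*-linear)) ⟩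
  const (c 0) ⊕ 0ₚ                       ≈⟨ ⊕-identityʳ (const (c 0)) ⟩
  const (c 0)                            ≈⟨ const-cong c0≡ ⟩
  const (ι 1 * c 0 + ¼ * (ι 1 * c 1))    ∎
  where
  open ≈-Reasoning
  c0≡ : c 0 ≡ ι 1 * c 0 + ¼ * (ι 1 * c 1)
  c0≡ rewrite c-vanishes 1 z<s = solve 1 (λ x → x := con (ι 1) :* x :+ con ¼ :* (con (ι 1) :* con 0ℚ)) refl (c 0)
∂-[X-½]*Uexp (suc n) c c-vanishes = begin
  ∂ ([X-½]* E)                                          ≈⟨ ∂-[X-½]* E ⟩
  E ⊕ [X-½]* ∂ E                                        ≈⟨ ⊕-congʳ E (map-≈ [X-½]*-linear (∂-Uexp n c)) ⟩
  E ⊕ [X-½]* [X-½]* Uexp n c′                           ≈⟨ ⊕-congʳ E ([X-½]*[X-½]* (Uexp n c′)) ⟩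
  E ⊕ (ι 2 · U* Uexp n c′ ⊕ ¼ · Uexp n c′)              ≈⟨ ⊕-congʳ E (⊕-cong (map-≈ (·-linear (ι 2)) (U*Uexp n c′))
                                                                              (map-≈ (·-linear ¼) (≈-sym (Uexp-suc n c′ c′-top)))) ⟩
  E ⊕ (ι 2 · Uexp (suc n) (0∷ c′) ⊕ ¼ · Uexp (suc n) c′)  ≈⟨ ⊕-congʳ E (⊕-cong (Uexp-· (suc n) (ι 2) (0∷ c′)) (Uexp-· (suc n) ¼ c′)) ⟩
  E ⊕ (Uexp (suc n) d₁ ⊕ Uexp (suc n) d₂)               ≈⟨ ⊕-congʳ E (Uexp-⊕ (suc n) d₁ d₂) ⟩
  E ⊕ Uexp (suc n) (λ j → d₁ j + d₂ j)                  ≈⟨ Uexp-⊕ (suc n) c (λ j → d₁ j + d₂ j) ⟩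
  Uexp (suc n) (λ j → c j + (d₁ j + d₂ j))              ≈⟨ Uexp-cong (suc n) coeff ⟩
  Uexp (suc n) (λ j → ι (suc (j ℕ.+ j)) * c j + ¼ * (ι (suc j) * c (suc j))) ∎
  where
  open ≈-Reasoning
  E = Uexp (suc n) c
  c′ = λ j → ι (suc j) * c (suc j)
  d₁ = λ j → ι 2 * (0∷ c′) j
  d₂ = λ j → ¼ * c′ j
  c′-top : c′ (suc n) ≡ 0ℚ
  c′-top = trans (cong (ι (suc (suc n)) *_) (c-vanishes (suc (suc n)) (s<s (s<s ℕP.≤-refl)))) (*-zeroʳ (ι (suc (suc n))))
  coeff : ∀ j → c j + (d₁ j + d₂ j) ≡ ι (suc (j ℕ.+ j)) * c j + ¼ * (ι (suc j) * c (suc j))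
  coeff zero = solve 2 (λ x y → x :+ (con (ι 2) :* con 0ℚ :+ con ¼ :* y) := con (ι 1) :* x :+ con ¼ :* y) refl (c 0) (c′ 0)
  coeff (suc j) = trans
    (solve 3 (λ t x y → x :+ (con (ι 2) :* (t :* x) :+ con ¼ :* y) := (con 1ℚ :+ con (ι 2) :* t) :* x :+ con ¼ :* y)
      refl (ι (suc j)) (c (suc j)) (c′ (suc j)))
    (cong (λ n → n * c (suc j) + ¼ * c′ (suc j)) (sym (ι-1+2n (suc j))))

bernCoeffs : ℕ → Poly
bernCoeffs k i = ι (k C i) * bernoulli (k ∸ i)

bernCoeffs-cong : ∀ {k k′} → k ≡ k′ → bernCoeffs k ≈ bernCoeffs k′
bernCoeffs-cong refl = ≈-refl

bernCoeffs-0 : ∀ k → bernCoeffs k 0 ≡ bernoulli k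
bernCoeffs-0 k = *-identityˡ (bernoulli k)

∂-bernCoeffs : ∀ k → ∂ (bernCoeffs (suc k)) ≈ ι (suc k) · bernCoeffs k
∂-bernCoeffs k = coeffwise λ i → begin
  ι (suc i) * (ι (suc k C suc i) * bernoulli (k ∸ i))  ≡⟨ *-assoc (ι (suc i)) _ _ ⟨
  ι (suc i) * ι (suc k C suc i) * bernoulli (k ∸ i)    ≡⟨ cong (_* bernoulli (k ∸ i)) (absorb i) ⟩
  ι (suc k) * ι (k C i) * bernoulli (k ∸ i)            ≡⟨ *-assoc (ι (suc k)) _ _ ⟩
  ι (suc k) * (ι (k C i) * bernoulli (k ∸ i))          ∎
  where
  open ≡-Reasoning
  absorb : ∀ i → ι (suc i) * ι (suc k C suc i) ≡ ι (suc k) * ι (k C i)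
  absorb i = begin
    ι (suc i) * ι (suc k C suc i)    ≡⟨ ι-* (suc i) (suc k C suc i) ⟨
    ι (suc i ℕ.* (suc k C suc i))    ≡⟨ cong ι ([1+i]*[1+k]C[1+i]≡[1+k]*kCi k i) ⟩
    ι (suc k ℕ.* (k C i))            ≡⟨ ι-* (suc k) (k C i) ⟩
    ι (suc k) * ι (k C i)            ∎

ev-bernCoeffs : ∀ k x → ev (suc k) (bernCoeffs k) x ≡ bernPoly k x
ev-bernCoeffs k x = sym (begin
  bernPoly k x                      ≡⟨ sumRange≡sum< 0 k term ⟩
  sum< (suc k) term                 ≡⟨ sum<-reverse (suc k) term ⟩
  sum< (suc k) (λ i → term (k ∸ i)) ≡⟨ sum<-cong-< (suc k) (λ i i<1+k → reindex i (ℕP.≤-pred i<1+k)) ⟩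
  ev (suc k) (bernCoeffs k) x       ∎)
  where
  open ≡-Reasoning
  term = λ j → ι (k C j) * bernoulli j * pow x (k ∸ j)
  reindex : ∀ i → i ℕ.≤ k → term (k ∸ i) ≡ bernCoeffs k i * pow x i
  reindex i i≤k = cong₂ (λ c e → ι c * bernoulli (k ∸ i) * pow x e) (sym (nCk≡nC[n∸k] i≤k)) (ℕP.m∸[m∸n]≡n i≤k)

pow-1 : ∀ n → pow 1ℚ n ≡ 1ℚ
pow-1 zero = refl
pow-1 (suc n) = trans (*-identityˡ (pow 1ℚ n)) (pow-1 n)

bernPoly-1 : ∀ n → bernPoly (suc (suc n)) 1ℚ ≡ bernoulli (suc (suc n))
bernPoly-1 n = begin
  bernPoly k 1ℚ                                 ≡⟨ sumRange≡sum< 0 k (λ j → term j * pow 1ℚ (k ∸ j)) ⟩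
  sum< (suc k) (λ j → term j * pow 1ℚ (k ∸ j))  ≡⟨ sum<-cong (suc k) (λ j → trans (cong (term j *_) (pow-1 (k ∸ j))) (*-identityʳ (term j))) ⟩
  sum< (suc k) term                             ≡⟨ sum<-suc k term ⟩
  sum< k term + term k                          ≡⟨ cong₂ _+_ (bernoulli-recurrence n) (cong (λ c → ι c * bernoulli k) (nCn≡1 k)) ⟩
  0ℚ + 1ℚ * bernoulli k                         ≡⟨ trans (+-identityˡ _) (*-identityˡ (bernoulli k)) ⟩
  bernoulli k                                   ∎
  where
  open ≡-Reasoning
  k = suc (suc n)
  term = λ j → ι (k C j) * bernoulli j

-- Back substitution

ε : ℕ → ℚ
ε zero = 1ℚ
ε (suc n) = - ε n

backSubst : (ℕ → ℚ) → ℕ → ℕ → ℚ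
backSubst r zero j = r j * 1/[1+ j ℕ.+ j ]
backSubst r (suc d) j = (r j - ¼ * (ι (suc j) * backSubst r d (suc j))) * 1/[1+ j ℕ.+ j ]

primitiveCoeffs : (ℕ → ℚ) → ℕ → ℕ → ℚ
primitiveCoeffs r m j = backSubst r (m ∸ j) j

module _ (r : ℕ → ℚ) (m : ℕ) (r-vanishes : ∀ j → m ℕ.< j → r j ≡ 0ℚ) where

  private
    c = primitiveCoeffs r m

  primitiveCoeffs-vanishes : ∀ j → m ℕ.< j → c j ≡ 0ℚ
  primitiveCoeffs-vanishes j m<j = begin
    backSubst r (m ∸ j) j      ≡⟨ cong (λ d → backSubst r d j) (ℕP.m≤n⇒m∸n≡0 (ℕP.<⇒≤ m<j)) ⟩
    r j * 1/[1+ j ℕ.+ j ]      ≡⟨ cong (_* 1/[1+ j ℕ.+ j ]) (r-vanishes j m<j) ⟩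
    0ℚ * 1/[1+ j ℕ.+ j ]       ≡⟨ *-zeroˡ 1/[1+ j ℕ.+ j ] ⟩
    0ℚ                         ∎
    where open ≡-Reasoning

  primitiveCoeffs-step : ∀ j → c j ≡ (r j - ¼ * (ι (suc j) * c (suc j))) * 1/[1+ j ℕ.+ j ]
  primitiveCoeffs-step j with j ℕP.<? m
  ... | yes j<m = cong (λ d → backSubst r d j) (ℕP.+-∸-assoc 1 j<m)
  ... | no j≮m = begin
    backSubst r (m ∸ j) j                        ≡⟨ cong (λ d → backSubst r d j) (ℕP.m≤n⇒m∸n≡0 m≤j) ⟩
    r j * w                                      ≡⟨ cong (_* w) (solve 2 (λ x t → x := x :- con ¼ :* (t :* con 0ℚ)) refl (r j) t) ⟩
    (r j - ¼ * (t * 0ℚ)) * w                     ≡⟨ cong (λ z → (r j - ¼ * (t * z)) * w) (primitiveCoeffs-vanishes (suc j) (s≤s m≤j)) ⟨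
    (r j - ¼ * (t * c (suc j))) * w              ∎
    where
    open ≡-Reasoning
    m≤j = ℕP.≮⇒≥ j≮m
    t = ι (suc j)
    w = 1/[1+ j ℕ.+ j ]

  primitiveCoeffs-solves : ∀ j → ι (suc (j ℕ.+ j)) * c j + ¼ * (ι (suc j) * c (suc j)) ≡ r j
  primitiveCoeffs-solves j = begin
    ι (suc (j ℕ.+ j)) * c j + y                            ≡⟨ cong (λ z → ι (suc (j ℕ.+ j)) * z + y) (primitiveCoeffs-step j) ⟩
    ι (suc (j ℕ.+ j)) * ((r j - y) * 1/[1+ j ℕ.+ j ]) + y  ≡⟨ cong (_+ y) (ι*[x*1/[1+]]≡x (j ℕ.+ j) (r j - y)) ⟩
    r j - y + y                                            ≡⟨ solve 2 (λ x y → x :- y :+ y := x) refl (r j) y ⟩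
    r j                                                    ∎
    where
    open ≡-Reasoning
    y = ¼ * (ι (suc j) * c (suc j))

  ∂-[X-½]*Uexp-primitive : ∂ ([X-½]* Uexp m c) ≈ Uexp m r
  ∂-[X-½]*Uexp-primitive = ≈-trans (∂-[X-½]*Uexp m c primitiveCoeffs-vanishes) (Uexp-cong m primitiveCoeffs-solves)

  primitiveCoeffs-step-signed : ∀ j →
    ε (m ℕ.+ j) * c j ≡ (¼ * (ι (suc j) * (ε (m ℕ.+ suc j) * c (suc j))) + ε (m ℕ.+ j) * r j) * 1/[1+ j ℕ.+ j ]
  primitiveCoeffs-step-signed j = begin
    e * c j                                                   ≡⟨ cong (e *_) (primitiveCoeffs-step j) ⟩
    e * ((r j - ¼ * (t * c (suc j))) * w)                     ≡⟨ solve 5 (λ e x t z w → e :* ((x :- con ¼ :* (t :* z)) :* w)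
                                                                   := (con ¼ :* (t :* (:- e :* z)) :+ e :* x) :* w) refl e (r j) t (c (suc j)) w ⟩
    (¼ * (t * (- e * c (suc j))) + e * r j) * w               ≡⟨ cong (λ e′ → (¼ * (t * (e′ * c (suc j))) + e * r j) * w) (cong ε (ℕP.+-suc m j)) ⟨
    (¼ * (t * (ε (m ℕ.+ suc j) * c (suc j))) + e * r j) * w  ∎
    where
    open ≡-Reasoning
    e = ε (m ℕ.+ j)
    t = ι (suc j)
    w = 1/[1+ j ℕ.+ j ]

  primitiveCoeffs-alternates : (∀ j → 1 ℕ.≤ j → j ℕ.≤ m → 0ℚ ≤ ε (m ℕ.+ j) * r j) → 0ℚ < ε (m ℕ.+ m) * r m →
    ∀ j → 1 ℕ.≤ j → j ℕ.≤ m → 0ℚ < ε (m ℕ.+ j) * c j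
  primitiveCoeffs-alternates r-nonneg r-top j 1≤j j≤m = downward (m ∸ j) j (ℕP.m+[n∸m]≡n j≤m) 1≤j
    where
    downward : ∀ d j → j ℕ.+ d ≡ m → 1 ℕ.≤ j → 0ℚ < ε (m ℕ.+ j) * c j
    downward d j j+d≡m 1≤j = subst (0ℚ <_) (sym (primitiveCoeffs-step-signed j)) (0<*0< (numerator d j+d≡m) (1/[1+]-pos (j ℕ.+ j)))
      where
      numerator : ∀ d → j ℕ.+ d ≡ m → 0ℚ < ¼ * (ι (suc j) * (ε (m ℕ.+ suc j) * c (suc j))) + ε (m ℕ.+ j) * r j
      numerator zero j+0≡m = subst (0ℚ <_) (sym first-term-vanishes) (subst (λ i → 0ℚ < ε (m ℕ.+ i) * r i) (sym j≡m) r-top)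
        where
        j≡m : j ≡ m
        j≡m = trans (sym (ℕP.+-identityʳ j)) j+0≡m
        first-term-vanishes : ¼ * (ι (suc j) * (ε (m ℕ.+ suc j) * c (suc j))) + ε (m ℕ.+ j) * r j ≡ ε (m ℕ.+ j) * r j
        first-term-vanishes = trans (cong (λ z → ¼ * (ι (suc j) * (ε (m ℕ.+ suc j) * z)) + ε (m ℕ.+ j) * r j)
                                          (primitiveCoeffs-vanishes (suc j) (s≤s (ℕP.≤-reflexive (sym j≡m)))))
                                    (solve 3 (λ e t x → con ¼ :* (t :* (e :* con 0ℚ)) :+ x := x) refl (ε (m ℕ.+ suc j)) (ι (suc j)) (ε (m ℕ.+ j) * r j))
      numerator (suc d) j+1+d≡m = 0<+0≤ (0<*0< (positive⁻¹ ¼) (0<*0< (ι-pos j) (downward d (suc j) (trans (sym (ℕP.+-suc j d)) j+1+d≡m) (s≤s z≤n))))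
                                        (r-nonneg j 1≤j (subst (j ℕ.≤_) j+1+d≡m (ℕP.m≤m+n j (suc d))))

-- The U-expansions of the Bernoulli polynomials

-- B₂ₘ(x) = Σⱼ evenCoeffs m j · U(x)ʲ and B₂ₘ₊₁(x) = (x − ½) Σⱼ oddCoeffs m j · U(x)ʲ; these are the
-- paper's b̂ⱼ⁽²ᵐ⁾ and b̂ⱼ⁽²ᵐ⁺¹⁾.
evenCoeffs oddCoeffs : ℕ → ℕ → ℚ
evenCoeffs zero zero = 1ℚ
evenCoeffs zero (suc j) = 0ℚ
evenCoeffs (suc m) zero = bernoulli (suc (suc (m ℕ.+ m)))
evenCoeffs (suc m) (suc j) = ι (suc (suc (m ℕ.+ m))) * oddCoeffs m j * 1/[1+ j ]
oddCoeffs m = primitiveCoeffs (λ j → ι (suc (m ℕ.+ m)) * evenCoeffs m j) m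

evenCoeffs-vanishes : ∀ m j → m ℕ.< j → evenCoeffs m j ≡ 0ℚ
oddCoeffs-vanishes : ∀ m j → m ℕ.< j → oddCoeffs m j ≡ 0ℚ
ι*evenCoeffs-vanishes : ∀ m j → m ℕ.< j → ι (suc (m ℕ.+ m)) * evenCoeffs m j ≡ 0ℚ

evenCoeffs-vanishes zero (suc j) _ = refl
evenCoeffs-vanishes (suc m) (suc j) (s<s m<j) =
  trans (cong (λ c → ι (suc (suc (m ℕ.+ m))) * c * 1/[1+ j ]) (oddCoeffs-vanishes m j m<j))
        (solve 2 (λ k w → k :* con 0ℚ :* w := con 0ℚ) refl (ι (suc (suc (m ℕ.+ m)))) 1/[1+ j ])

oddCoeffs-vanishes m = primitiveCoeffs-vanishes _ m (ι*evenCoeffs-vanishes m)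

ι*evenCoeffs-vanishes m j m<j = trans (cong (ι (suc (m ℕ.+ m)) *_) (evenCoeffs-vanishes m j m<j)) (*-zeroʳ (ι (suc (m ℕ.+ m))))

evenPoly oddPoly : ℕ → Poly
evenPoly m = Uexp m (evenCoeffs m)
oddPoly m = [X-½]* Uexp m (oddCoeffs m)

∂-oddPoly : ∀ m → ∂ (oddPoly m) ≈ ι (suc (m ℕ.+ m)) · evenPoly m
∂-oddPoly m = ≈-trans (∂-[X-½]*Uexp-primitive _ m (ι*evenCoeffs-vanishes m))
                      (≈-sym (Uexp-· m (ι (suc (m ℕ.+ m))) (evenCoeffs m)))

∂-evenPoly : ∀ m → ∂ (evenPoly (suc m)) ≈ ι (suc (suc (m ℕ.+ m))) · oddPoly m
∂-evenPoly m = begin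
  ∂ (Uexp (suc m) (evenCoeffs (suc m)))                         ≈⟨ ∂-Uexp m (evenCoeffs (suc m)) ⟩
  [X-½]* Uexp m (λ j → ι (suc j) * evenCoeffs (suc m) (suc j))  ≈⟨ map-≈ [X-½]*-linear (Uexp-cong m coeff) ⟩
  [X-½]* Uexp m (λ j → K * oddCoeffs m j)                       ≈⟨ map-≈ [X-½]*-linear (Uexp-· m K (oddCoeffs m)) ⟨
  [X-½]* (K · Uexp m (oddCoeffs m))                             ≈⟨ map-· [X-½]*-linear K (Uexp m (oddCoeffs m)) ⟩
  K · oddPoly m                                                 ∎
  where
  open ≈-Reasoning
  K = ι (suc (suc (m ℕ.+ m)))
  coeff : ∀ j → ι (suc j) * (K * oddCoeffs m j * 1/[1+ j ]) ≡ K * oddCoeffs m j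
  coeff j = ι*[x*1/[1+]]≡x j (K * oddCoeffs m j)

-- Used instead of conversion, which would unfold ev.
U[1]≡0 : U 1ℚ ≡ 0ℚ
U[1]≡0 = refl

ev-evenPoly : ∀ m x → ev (suc (m ℕ.+ m)) (evenPoly m) x ≡ ev (suc m) (evenCoeffs m) (U x)
ev-evenPoly m = ev-Uexp m (evenCoeffs m)

ev-oddPoly : ∀ m x → ev (suc (suc (m ℕ.+ m))) (oddPoly m) x ≡ (x - ½) * ev (suc m) (oddCoeffs m) (U x)
ev-oddPoly m x = trans (ev-[X-½]* (suc (m ℕ.+ m)) (Uexp m (oddCoeffs m)) x (Uexp-vanishes m (oddCoeffs m) (suc (m ℕ.+ m)) ℕP.≤-refl))
                       (cong ((x - ½) *_) (ev-Uexp m (oddCoeffs m) x))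

-- P(1) − P(0) = (k+1) ∫₀¹ p determines the constant term of p from its other coefficients.
constant-term-from-primitives : ∀ k N p q P Q → ∂ P ≈ ι (suc k) · p → ∂ Q ≈ ι (suc k) · q →
  (∀ i → p (suc i) ≡ q (suc i)) → P 0 ≡ Q 0 → ev (suc (suc N)) P 1ℚ ≡ ev (suc (suc N)) Q 1ℚ → p 0 ≡ q 0
constant-term-from-primitives k N p q P Q ∂P ∂Q p≡q-from-1 P0≡Q0 P[1]≡Q[1] = ι-cancelˡ k (begin
  ι (suc k) * p 0   ≡⟨ at ∂P 0 ⟨
  ι 1 * P 1         ≡⟨ cong (ι 1 *_) (coeff-1-from-value-at-1 N P Q P0≡Q0 P≡Q-from-2 P[1]≡Q[1]) ⟩
  ι 1 * Q 1         ≡⟨ at ∂Q 0 ⟩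
  ι (suc k) * q 0   ∎)
  where
  open ≡-Reasoning
  P≡Q-from-2 : ∀ i → P (suc (suc i)) ≡ Q (suc (suc i))
  P≡Q-from-2 i = ι-cancelˡ (suc i) (trans (at ∂P (suc i)) (trans (cong (ι (suc k) *_) (p≡q-from-1 i)) (sym (at ∂Q (suc i)))))

evenPoly≈bernCoeffs : ∀ m → evenPoly m ≈ bernCoeffs (m ℕ.+ m)
oddPoly≈bernCoeffs : ∀ m → oddPoly m ≈ bernCoeffs (suc (m ℕ.+ m))

evenPoly≈bernCoeffs zero = coeffwise λ where
  zero → refl
  (suc i) → refl
evenPoly≈bernCoeffs (suc m) = ≈-trans (∂-injective ∂-agree constant-terms) (bernCoeffs-cong (sym (cong suc (ℕP.+-suc m m))))
  where
  k = suc (suc (m ℕ.+ m))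
  ∂-agree : ∂ (evenPoly (suc m)) ≈ ∂ (bernCoeffs k)
  ∂-agree = ≈-trans (∂-evenPoly m) (≈-trans (map-≈ (·-linear (ι k)) (oddPoly≈bernCoeffs m)) (≈-sym (∂-bernCoeffs (suc (m ℕ.+ m)))))
  constant-terms : evenPoly (suc m) 0 ≡ bernCoeffs k 0
  constant-terms = trans (Uexp-0 (suc m) (evenCoeffs (suc m))) (sym (bernCoeffs-0 k))

oddPoly≈bernCoeffs m = ∂-injective ∂-agree (constant-term-from-primitives k k (oddPoly m) (bernCoeffs k) (evenPoly (suc m)) (bernCoeffs (suc k))
  (∂-evenPoly m) (∂-bernCoeffs k) (λ i → ι-cancelˡ i (at ∂-agree i)) constant-terms values-at-1)
  where
  k = suc (m ℕ.+ m)
  ∂-agree : ∂ (oddPoly m) ≈ ∂ (bernCoeffs k)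
  ∂-agree = ≈-trans (∂-oddPoly m) (≈-trans (map-≈ (·-linear (ι k)) (evenPoly≈bernCoeffs m)) (≈-sym (∂-bernCoeffs (m ℕ.+ m))))
  constant-terms : evenPoly (suc m) 0 ≡ bernCoeffs (suc k) 0
  constant-terms = trans (Uexp-0 (suc m) (evenCoeffs (suc m))) (sym (bernCoeffs-0 (suc k)))
  values-at-1 : ev (suc (suc k)) (evenPoly (suc m)) 1ℚ ≡ ev (suc (suc k)) (bernCoeffs (suc k)) 1ℚ
  values-at-1 = begin
    ev (suc (suc k)) (evenPoly (suc m)) 1ℚ           ≡⟨ cong (λ N → ev (suc (suc N)) (evenPoly (suc m)) 1ℚ) (ℕP.+-suc m m) ⟨
    ev (suc (suc m ℕ.+ suc m)) (evenPoly (suc m)) 1ℚ ≡⟨ ev-evenPoly (suc m) 1ℚ ⟩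
    ev (suc (suc m)) (evenCoeffs (suc m)) (U 1ℚ)     ≡⟨ cong (ev (suc (suc m)) (evenCoeffs (suc m))) U[1]≡0 ⟩
    ev (suc (suc m)) (evenCoeffs (suc m)) 0ℚ         ≡⟨ ev-at-0 (suc m) (evenCoeffs (suc m)) ⟩
    bernoulli (suc k)                                ≡⟨ bernPoly-1 (m ℕ.+ m) ⟨
    bernPoly (suc k) 1ℚ                              ≡⟨ ev-bernCoeffs (suc k) 1ℚ ⟨
    ev (suc (suc k)) (bernCoeffs (suc k)) 1ℚ         ∎
    where open ≡-Reasoning

oddPoly-0 : ∀ m → oddPoly m 0 ≡ -½ * oddCoeffs m 0
oddPoly-0 m = trans (cong (λ c → 0ℚ + -½ * c) (Uexp-0 m (oddCoeffs m))) (+-identityˡ (-½ * oddCoeffs m 0))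

bernoulli-odd≡-½*oddCoeffs₀ : ∀ m → bernoulli (suc (m ℕ.+ m)) ≡ -½ * oddCoeffs m 0
bernoulli-odd≡-½*oddCoeffs₀ m = trans (sym (bernCoeffs-0 (suc (m ℕ.+ m)))) (trans (sym (at (oddPoly≈bernCoeffs m) 0)) (oddPoly-0 m))

oddCoeffs-0 : ∀ n → oddCoeffs (suc n) 0 ≡ 0ℚ
oddCoeffs-0 n = begin
  c₀                          ≡⟨ solve 1 (λ x → x := (con 1ℚ :- con ½) :* x :- con -½ :* x) refl c₀ ⟩
  (1ℚ - ½) * c₀ - -½ * c₀     ≡⟨ cong (_- -½ * c₀) value-at-1 ⟩
  -½ * c₀ - -½ * c₀           ≡⟨ solve 1 (λ x → con -½ :* x :- con -½ :* x := con 0ℚ) refl c₀ ⟩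
  0ℚ                          ∎
  where
  open ≡-Reasoning
  m = suc n
  k = suc (m ℕ.+ m)
  c₀ = oddCoeffs m 0
  value-at-1 : (1ℚ - ½) * c₀ ≡ -½ * c₀
  value-at-1 = begin
    (1ℚ - ½) * c₀                                ≡⟨ cong ((1ℚ - ½) *_) (ev-at-0 m (oddCoeffs m)) ⟨
    (1ℚ - ½) * ev (suc m) (oddCoeffs m) 0ℚ       ≡⟨ cong (λ y → (1ℚ - ½) * ev (suc m) (oddCoeffs m) y) U[1]≡0 ⟨
    (1ℚ - ½) * ev (suc m) (oddCoeffs m) (U 1ℚ)   ≡⟨ ev-oddPoly m 1ℚ ⟨
    ev (suc k) (oddPoly m) 1ℚ                    ≡⟨ ev-cong (suc k) 1ℚ (oddPoly≈bernCoeffs m) ⟩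
    ev (suc k) (bernCoeffs k) 1ℚ                 ≡⟨ ev-bernCoeffs k 1ℚ ⟩
    bernPoly k 1ℚ                                ≡⟨ bernPoly-1 (n ℕ.+ suc n) ⟩
    bernoulli k                                  ≡⟨ bernoulli-odd≡-½*oddCoeffs₀ m ⟩
    -½ * c₀                                      ∎

bernoulli-odd : ∀ n → bernoulli (suc (suc n ℕ.+ suc n)) ≡ 0ℚ
bernoulli-odd n = trans (bernoulli-odd≡-½*oddCoeffs₀ (suc n)) (trans (cong (-½ *_) (oddCoeffs-0 n)) (*-zeroʳ -½))

evenCoeffs-1 : ∀ n → evenCoeffs (suc (suc n)) 1 ≡ 0ℚ
evenCoeffs-1 n = trans (cong (λ c → ι (suc (suc (suc n ℕ.+ suc n))) * c * 1/[1+ 0 ]) (oddCoeffs-0 n))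
                       (solve 2 (λ k w → k :* con 0ℚ :* w := con 0ℚ) refl (ι (suc (suc (suc n ℕ.+ suc n)))) 1/[1+ 0 ])

ε-suc-suc : ∀ n → ε (suc (suc n)) ≡ ε n
ε-suc-suc n = solve 1 (λ x → :- (:- x) := x) refl (ε n)

-- Non-strict in general since the U-coefficient of B₂ₘ vanishes for m ≥ 2.
record EvenSigns (m : ℕ) : Set where
  field
    nonneg : ∀ j → 1 ℕ.≤ j → j ℕ.≤ m → 0ℚ ≤ ε (m ℕ.+ j) * evenCoeffs m j
    top-pos : 0ℚ < ε (m ℕ.+ m) * evenCoeffs m m

OddSigns : ℕ → Set
OddSigns m = ∀ j → 1 ℕ.≤ j → j ℕ.≤ m → 0ℚ < ε (m ℕ.+ j) * oddCoeffs m j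

oddSigns : ∀ m → EvenSigns m → OddSigns m
oddSigns m signs = primitiveCoeffs-alternates r m (ι*evenCoeffs-vanishes m)
  (λ j 1≤j j≤m → subst (0ℚ ≤_) (ε-scaled j) (0≤*0≤ (<⇒≤ K-pos) (EvenSigns.nonneg signs j 1≤j j≤m)))
  (subst (0ℚ <_) (ε-scaled m) (0<*0< K-pos (EvenSigns.top-pos signs)))
  where
  K = ι (suc (m ℕ.+ m))
  r = λ j → K * evenCoeffs m j
  K-pos : 0ℚ < K
  K-pos = ι-pos (m ℕ.+ m)
  ε-scaled : ∀ j → K * (ε (m ℕ.+ j) * evenCoeffs m j) ≡ ε (m ℕ.+ j) * r j
  ε-scaled j = solve 3 (λ k e a → k :* (e :* a) := e :* (k :* a)) refl K (ε (m ℕ.+ j)) (evenCoeffs m j)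

evenCoeffs-signed : ∀ m j → ε (suc m ℕ.+ suc j) * evenCoeffs (suc m) (suc j) ≡
                            ι (suc (suc (m ℕ.+ m))) * 1/[1+ j ] * (ε (m ℕ.+ j) * oddCoeffs m j)
evenCoeffs-signed m j = trans
  (cong (_* evenCoeffs (suc m) (suc j)) (trans (cong (ε ∘ suc) (ℕP.+-suc m j)) (ε-suc-suc (m ℕ.+ j))))
  (solve 4 (λ e k c w → e :* (k :* c :* w) := k :* w :* (e :* c)) refl (ε (m ℕ.+ j)) (ι (suc (suc (m ℕ.+ m)))) (oddCoeffs m j) 1/[1+ j ])

evenCoeffs-pos : ∀ m → OddSigns m → ∀ j → 1 ℕ.≤ j → j ℕ.≤ m → 0ℚ < ε (suc m ℕ.+ suc j) * evenCoeffs (suc m) (suc j)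
evenCoeffs-pos m odd j 1≤j j≤m = subst (0ℚ <_) (sym (evenCoeffs-signed m j))
  (0<*0< (0<*0< (ι-pos (suc (m ℕ.+ m))) (1/[1+]-pos j)) (odd j 1≤j j≤m))

-- B₂(x) = 1/6 + 2 U(x)
evenSigns-1 : EvenSigns 1
evenSigns-1 = record { nonneg = nonneg ; top-pos = top-pos }
  where
  top-pos : 0ℚ < ε 2 * evenCoeffs 1 1
  top-pos = ι-pos 1
  nonneg : ∀ j → 1 ℕ.≤ j → j ℕ.≤ 1 → 0ℚ ≤ ε (1 ℕ.+ j) * evenCoeffs 1 j
  nonneg 1 _ _ = <⇒≤ top-pos
  nonneg (suc (suc j)) _ (s≤s ())

evenSigns-suc : ∀ n → OddSigns (suc n) → EvenSigns (suc (suc n))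
evenSigns-suc n odd = record { nonneg = nonneg ; top-pos = evenCoeffs-pos m odd m (s≤s z≤n) ℕP.≤-refl }
  where
  m = suc n
  nonneg : ∀ j → 1 ℕ.≤ j → j ℕ.≤ suc m → 0ℚ ≤ ε (suc m ℕ.+ j) * evenCoeffs (suc m) j
  nonneg 1 _ _ = ≤-reflexive (sym (trans (cong (ε (suc m ℕ.+ 1) *_) (evenCoeffs-1 n)) (*-zeroʳ (ε (suc m ℕ.+ 1)))))
  nonneg (suc (suc j)) _ (s≤s j<m) = <⇒≤ (evenCoeffs-pos m odd (suc j) (s≤s z≤n) j<m)

evenSigns : ∀ n → EvenSigns (suc n)
evenSigns zero = evenSigns-1
evenSigns (suc n) = evenSigns-suc n (oddSigns (suc n) (evenSigns n))

evenCoeffs-nonzero : ∀ n j → 2 ℕ.≤ j → j ℕ.≤ suc (suc n) → evenCoeffs (suc (suc n)) j ≢ 0ℚ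
evenCoeffs-nonzero n (suc j) (s≤s 1≤j) (s≤s j≤1+n) =
  0<*⇒≢0 (ε (suc (suc n) ℕ.+ suc j)) (evenCoeffs-pos (suc n) (oddSigns (suc n) (evenSigns n)) j 1≤j j≤1+n)

oddCoeffs-nonzero : ∀ n j → 1 ℕ.≤ j → j ℕ.≤ suc n → oddCoeffs (suc n) j ≢ 0ℚ
oddCoeffs-nonzero n j 1≤j j≤1+n = 0<*⇒≢0 (ε (suc n ℕ.+ j)) (oddSigns (suc n) (evenSigns n) j 1≤j j≤1+n)

2*m≡m+m : ∀ m → 2 ℕ.* m ≡ m ℕ.+ m
2*m≡m+m m = cong (m ℕ.+_) (ℕP.+-identityʳ m)

ev≡a₀+sumRange : ∀ m a y → ev (suc m) a y ≡ a 0 + sumRange 1 m (λ j → a j * pow y j)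
ev≡a₀+sumRange m a y = cong₂ _+_ (*-identityʳ (a 0)) (sym (sumRange≡sum< 1 m (λ j → a j * pow y j)))

bernPoly-even-expansion : ∀ n x → let m = suc (suc n) in
  bernPoly (2 ℕ.* m) x ≡ bernoulli (2 ℕ.* m) + sumRange 2 m (λ j → evenCoeffs m j * pow (U x) j)
bernPoly-even-expansion n x = begin
  bernPoly (2 ℕ.* m) x                                     ≡⟨ cong (λ k → bernPoly k x) (2*m≡m+m m) ⟩
  bernPoly (m ℕ.+ m) x                                     ≡⟨ ev-bernCoeffs (m ℕ.+ m) x ⟨
  ev (suc (m ℕ.+ m)) (bernCoeffs (m ℕ.+ m)) x              ≡⟨ ev-cong (suc (m ℕ.+ m)) x (evenPoly≈bernCoeffs m) ⟨
  ev (suc (m ℕ.+ m)) (evenPoly m) x                        ≡⟨ ev-evenPoly m x ⟩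
  ev (suc m) a (U x)                                       ≡⟨ cong₂ (λ b₀ s → b₀ + (a 1 * pow (U x) 1 + s)) (*-identityʳ (a 0)) (sym (sumRange≡sum< 2 m g)) ⟩
  a 0 + (a 1 * pow (U x) 1 + sumRange 2 m g)               ≡⟨ cong₂ (λ b₀ b₁ → b₀ + (b₁ * pow (U x) 1 + sumRange 2 m g)) a₀≡B (evenCoeffs-1 n) ⟩
  bernoulli (2 ℕ.* m) + (0ℚ * pow (U x) 1 + sumRange 2 m g) ≡⟨ cong (bernoulli (2 ℕ.* m) +_) (trans (cong (_+ sumRange 2 m g) (*-zeroˡ (pow (U x) 1))) (+-identityˡ _)) ⟩
  bernoulli (2 ℕ.* m) + sumRange 2 m g                      ∎
  where
  open ≡-Reasoning
  m = suc (suc n)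
  a = evenCoeffs m
  g = λ j → a j * pow (U x) j
  a₀≡B : a 0 ≡ bernoulli (2 ℕ.* m)
  a₀≡B = begin
    a 0                        ≡⟨ Uexp-0 m a ⟨
    evenPoly m 0               ≡⟨ at (evenPoly≈bernCoeffs m) 0 ⟩
    bernCoeffs (m ℕ.+ m) 0     ≡⟨ bernCoeffs-0 (m ℕ.+ m) ⟩
    bernoulli (m ℕ.+ m)        ≡⟨ cong bernoulli (2*m≡m+m m) ⟨
    bernoulli (2 ℕ.* m)        ∎

bernPoly-odd-expansion : ∀ n x → let m = suc n in
  bernPoly (suc (2 ℕ.* m)) x ≡ (x - ½) * sumRange 1 m (λ j → oddCoeffs m j * pow (U x) j)
bernPoly-odd-expansion n x = begin
  bernPoly (suc (2 ℕ.* m)) x                         ≡⟨ cong (λ k → bernPoly (suc k) x) (2*m≡m+m m) ⟩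
  bernPoly (suc (m ℕ.+ m)) x                         ≡⟨ ev-bernCoeffs (suc (m ℕ.+ m)) x ⟨
  ev (suc (suc (m ℕ.+ m))) (bernCoeffs (suc (m ℕ.+ m))) x  ≡⟨ ev-cong (suc (suc (m ℕ.+ m))) x (oddPoly≈bernCoeffs m) ⟨
  ev (suc (suc (m ℕ.+ m))) (oddPoly m) x             ≡⟨ ev-oddPoly m x ⟩
  (x - ½) * ev (suc m) c (U x)                       ≡⟨ cong ((x - ½) *_) (ev≡a₀+sumRange m c (U x)) ⟩
  (x - ½) * (c 0 + sumRange 1 m g)                   ≡⟨ cong (λ c₀ → (x - ½) * (c₀ + sumRange 1 m g)) (oddCoeffs-0 n) ⟩
  (x - ½) * (0ℚ + sumRange 1 m g)                    ≡⟨ cong ((x - ½) *_) (+-identityˡ (sumRange 1 m g)) ⟩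
  (x - ½) * sumRange 1 m g                           ∎
  where
  open ≡-Reasoning
  m = suc n
  c = oddCoeffs m
  g = λ j → c j * pow (U x) j

bernoulli-odd-vanishes : ∀ i → 1 ℕ.≤ i → bernoulli (suc (2 ℕ.* i)) ≡ 0ℚ
bernoulli-odd-vanishes (suc i) _ = trans (cong (bernoulli ∘ suc) (2*m≡m+m (suc i))) (bernoulli-odd i)

theorem2 :
  ((m : ℕ) → 2 ℕ.≤ m →
    ((∀ i → 1 ℕ.≤ i → i ℕ.< m → bernoulli (suc (2 ℕ.* i)) ≡ 0ℚ)
      ⇔ Σ (ℕ → ℚ) (λ b → (∀ j → 2 ℕ.≤ j → j ℕ.≤ m → b j ≢ 0ℚ) ×
          (∀ (x : ℚ) → bernPoly (2 ℕ.* m) x ≡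
             bernoulli (2 ℕ.* m) + (sumRange 2 m (λ j → b j * pow (U x) j))))))
  ×
  ((m : ℕ) → 1 ℕ.≤ m →
    ((∀ i → 1 ℕ.≤ i → i ℕ.≤ m → bernoulli (suc (2 ℕ.* i)) ≡ 0ℚ)
      ⇔ Σ (ℕ → ℚ) (λ b → (∀ j → 1 ℕ.≤ j → j ℕ.≤ m → b j ≢ 0ℚ) ×
          (∀ (x : ℚ) → bernPoly (suc (2 ℕ.* m)) x ≡
             (x - ½) * (sumRange 1 m (λ j → b j * pow (U x) j))))))
-- Neither direction uses its hypothesis: both sides hold outright, as B₂ᵢ₊₁ = 0 for all i ≥ 1.
theorem2 = (λ where
    (suc (suc n)) _ → mk⇔ (λ _ → evenCoeffs (suc (suc n)) , evenCoeffs-nonzero n , bernPoly-even-expansion n)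
                          (λ _ i 1≤i _ → bernoulli-odd-vanishes i 1≤i)
    (suc zero) (s≤s ()))
  , (λ where
    (suc n) _ → mk⇔ (λ _ → oddCoeffs (suc n) , oddCoeffs-nonzero n , bernPoly-odd-expansion n)
                    (λ _ i 1≤i _ → bernoulli-odd-vanishes i 1≤i))
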